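{- For every $\ell\in\mathbb N$, the $\ell$-by-$\ell$ grid graph $\boxplus_\ell$ satisfies $\gamma(\boxplus_\ell)\ge(\ell-1)/6$.
   Context: $\boxplus_\ell$ has vertex set $[\ell]\times[\ell]$, with $(a,b)$ and $(a',b')$ adjacent iff $|a-a'|+|b-b'|=1$. The blowup $H\otimes J_t$ has vertices $v^{(i)}$ ($v\in V(H)$, $i\in[t]$) and edges $u^{(i)}v^{(j)}$ for $uv\in E(H)$, $i,j\in[t]$, and $u^{(i)}u^{(j)}$ for $u\in V(H)$, $i\ne j$. A matching on a vertex set $X$ is a set of pairwise disjoint pairs of distinct elements of $X$ (not necessarily edges). For a graph $H'$, $X\subseteq V(H')$ is matching-linked if for every matching $M$ on $X$ there are pairwise vertex-disjoint paths in $H'$, one for each pair $\{u,v\}\in M$, with endpoints $u,v$. The linkage capacity $\gamma(H)$ is the supremum of all $c>0$ such that for all sufficiently large $t$, $H\otimes J_t$ contains a matching-linked set of size $\lfloor ct\rfloor$. -}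

module Defs where

open import Data.Nat as ℕ using (ℕ)
open import Data.Integer as ℤ using (ℤ; +_; -[1+_])
open import Data.Rational as ℚ using (ℚ; floor; _/_)
open import Data.Fin using (Fin; toℕ)
open import Data.Product using (_×_; _,_; Σ; ∃; ∃-syntax)
open import Data.Sum using (_⊎_)
open import Data.List using (List; []; _∷_; length; concat; concatMap)
open import Data.List.Membership.Propositional using (_∈_)
open import Data.List.Relation.Unary.All using (All)
open import Data.List.Relation.Unary.Unique.Propositional using (Unique)
open import Data.List.Relation.Binary.Pointwise using (Pointwise)
open import Relation.Binary.PropositionalEquality using (_≡_; _≢_)

dist : ℕ → ℕ → ℕ
dist a b = ℕ.∣ a - b ∣′
  where open import Data.Nat using (∣_-_∣′)

GridV : ℕ → Set
GridV ℓ = Fin ℓ × Fin ℓ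

GridAdj : (ℓ : ℕ) → GridV ℓ → GridV ℓ → Set
GridAdj ℓ (a , b) (a' , b') = dist (toℕ a) (toℕ a') ℕ.+ dist (toℕ b) (toℕ b') ≡ 1

-- blowup H ⊗ J_t of the grid: vertex v^(i) is (v , i)
BlowV : ℕ → ℕ → Set
BlowV ℓ t = GridV ℓ × Fin t

BlowAdj : (ℓ t : ℕ) → BlowV ℓ t → BlowV ℓ t → Set
BlowAdj ℓ t (u , i) (v , j) = GridAdj ℓ u v ⊎ (u ≡ v × i ≢ j)

data IsWalk {V : Set} (Adj : V → V → Set) : V → V → List V → Set where
  single : ∀ {u} → IsWalk Adj u u (u ∷ [])
  step   : ∀ {u w v ws} → Adj u w → IsWalk Adj w v ws → IsWalk Adj u v (u ∷ ws)

endpoints : {V : Set} → List (V × V) → List V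
endpoints [] = []
endpoints ((u , v) ∷ M) = u ∷ v ∷ endpoints M

IsMatchingOn : {V : Set} → List V → List (V × V) → Set
IsMatchingOn X M = All (_∈ X) (endpoints M) × Unique (endpoints M)

Links : {V : Set} (Adj : V → V → Set) → List V → V × V → Set
Links Adj P (u , v) = IsWalk Adj u v P

-- X (a duplicate-free list of vertices) is matching-linked: every matching on X
-- is realised by paths, one per pair, whose vertex lists together are duplicate-free
-- (so each is a path and they are pairwise vertex-disjoint)
MatchingLinked : {V : Set} (Adj : V → V → Set) → List V → Set
MatchingLinked Adj X =
  (M : List _) → IsMatchingOn X M →
  ∃[ Ps ] (Pointwise (Links Adj) Ps M × Unique (concat Ps))

-- c is admissible for γ(⊞_ℓ): for all sufficiently large t, ⊞_ℓ ⊗ J_t contains a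
-- matching-linked set of size ⌊ c t ⌋
Admissible : ℕ → ℚ → Set
Admissible ℓ c =
  ∃[ T ] ∀ t → T ℕ.≤ t →
    ∃[ X ] (Unique X × MatchingLinked (BlowAdj ℓ t) X
            × (+ length X) ≡ floor (c ℚ.* ((+ t) / 1)))

{-# OPTIONS --safe #-}
module Submission where

-- Split the t copies of every vertex of ⊞_ℓ into the low layers k < s = ⌊t/2⌋ and the high
-- layers s + c (c < s). The terminals are the copies (0, i)^(c) of the top row in the low layers,
-- ℓ·s of them. Terminals (i, c) and (j, c′) are joined by going down column i in layer c to row i,
-- along row i in layer s + c to column j, and up column j in layer c′. A low vertex (r, col)^(k)
-- is only ever used by the terminal (col, k) and a high vertex (r, col)^(s + c) only by (r, c),
-- so the paths of a matching are pairwise disjoint. As ℓ⌊t/2⌋ ≥ ⌊(ℓ − 1)t/6⌋ for t ≥ 2, a prefix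
-- of the terminals has the required size.

open import Defs

module FloorOfFractions where

  open import Data.Nat as ℕ using (ℕ; zero; suc; NonZero)
  import Data.Nat.Properties as ℕP
  import Data.Nat.DivMod as ℕD
  open import Data.Integer as ℤ using (ℤ; +_; -[1+_])
  import Data.Integer.Properties as ℤP
  open import Data.Integer.Tactic.RingSolver using (solve-∀)
  open import Data.Integer.GCD using (gcd)
  open import Data.Rational as ℚ using (ℚ; mkℚ; floor; _/_; ↥_; ↧_)
  import Data.Rational.Properties as ℚP
  open import Data.Product using (∃-syntax; _×_; _,_)
  open import Relation.Nullary using (contradiction)
  open import Relation.Binary.PropositionalEquality

  -- m / n is p written with the common factor k, i.e. not necessarily in lowest terms.
  _≐_/_ : ℚ → ℕ → ℕ → Set
  p ≐ m / n = ∃[ k ] (↥ p ℤ.* k ≡ + m × ↧ p ℤ.* k ≡ + n)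

  /-≐ : ∀ m n .{{_ : NonZero n}} → (+ m / n) ≐ m / n
  /-≐ m n = gcd (+ m) (+ n) , ℚP.↥-/ (+ m) n , ℚP.↧-/ (+ m) n

  *-≐ : ∀ p q {m n d e} → p ≐ m / d → q ≐ n / e → (p ℚ.* q) ≐ (m ℕ.* n) / (d ℕ.* e)
  *-≐ p q {m} {n} {d} {e} (k , ↥p*k , ↧p*k) (l , ↥q*l , ↧q*l) =
    g ℤ.* (k ℤ.* l) ,
    trans (scale (↥ (p ℚ.* q)) (↥ p) (↥ q) (ℚP.↥-* p q) ↥p*k ↥q*l) (sym (ℤP.pos-* m n)) ,
    trans (scale (↧ (p ℚ.* q)) (↧ p) (↧ q) (ℚP.↧-* p q) ↧p*k ↧q*l) (sym (ℤP.pos-* d e))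
    where
    g = gcd (↥ p ℤ.* ↥ q) (↧ p ℤ.* ↧ q)
    open ≡-Reasoning
    interchange : ∀ b c y z → (b ℤ.* c) ℤ.* (y ℤ.* z) ≡ (b ℤ.* y) ℤ.* (c ℤ.* z)
    interchange = solve-∀
    scale : ∀ a b c {u v} → a ℤ.* g ≡ b ℤ.* c → b ℤ.* k ≡ u → c ℤ.* l ≡ v →
            a ℤ.* (g ℤ.* (k ℤ.* l)) ≡ u ℤ.* v
    scale a b c {u} {v} ag≡bc bk≡u cl≡v = begin
      a ℤ.* (g ℤ.* (k ℤ.* l))   ≡⟨ ℤP.*-assoc a g (k ℤ.* l) ⟨
      (a ℤ.* g) ℤ.* (k ℤ.* l)   ≡⟨ cong (ℤ._* (k ℤ.* l)) ag≡bc ⟩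
      (b ℤ.* c) ℤ.* (k ℤ.* l)   ≡⟨ interchange b c k l ⟩
      (b ℤ.* k) ℤ.* (c ℤ.* l)   ≡⟨ cong₂ ℤ._*_ bk≡u cl≡v ⟩
      u ℤ.* v                   ∎

  floor-≐ : ∀ p {m n} .{{_ : NonZero n}} → p ≐ m / n → floor p ≡ + (m ℕ./ n)
  floor-≐ p {n = n} (+ zero , _ , ↧p*0≡n) =
    contradiction (ℤP.+-injective (trans (sym ↧p*0≡n) (ℤP.*-zeroʳ (↧ p)))) (ℕ.≢-nonZero⁻¹ n)
  floor-≐ (mkℚ _ _ _) ( -[1+ _ ] , _ , ())
  floor-≐ (mkℚ -[1+ _ ] _ _) (+ suc _ , () , _)
  floor-≐ p@(mkℚ (+ x) d _) {m} {n} (+ suc g , x*g≡m , d*g≡n) = begin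
    floor p                                ≡⟨ ℤP.*-identityˡ _ ⟩
    + (x ℕ./ suc d)                        ≡⟨ cong +_ (ℕD.m*n/o*n≡m/o x (suc g) (suc d)) ⟨
    + (x ℕ.* suc g ℕ./ (suc d ℕ.* suc g)) ≡⟨ cong +_ (ℕD./-congˡ (as-ℕ x (suc g) x*g≡m)) ⟩
    + (m ℕ./ (suc d ℕ.* suc g))            ≡⟨ cong +_ (ℕD./-congʳ (as-ℕ (suc d) (suc g) d*g≡n)) ⟩
    + (m ℕ./ n)                            ∎
    where
    open ≡-Reasoning
    as-ℕ : ∀ a b {c} → + a ℤ.* + b ≡ + c → a ℕ.* b ≡ c
    as-ℕ a b e = ℤP.+-injective (trans (ℤP.pos-* a b) e)

  ⌊m/d*n⌋≡m*n/d : ∀ m n d .{{_ : NonZero d}} → floor ((+ m / d) ℚ.* (+ n / 1)) ≡ + (m ℕ.* n ℕ./ d)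
  ⌊m/d*n⌋≡m*n/d m n d = trans (floor-≐ (p ℚ.* q) {{ℕP.m*n≢0 d 1}} (*-≐ p q (/-≐ m d) (/-≐ n 1)))
    (cong +_ (ℕD./-congʳ {{ℕP.m*n≢0 d 1}} (ℕP.*-identityʳ d)))
    where
    p = + m / d
    q = + n / 1

module Linkage where

  open import Data.Nat as ℕ
    using (ℕ; zero; suc; z≤n; s≤s; z<s; s<s; NonZero; _<_; _≤_; _+_; _*_; _/_; _∸_; ∣_-_∣; _<?_; ⌊_/2⌋; ⌈_/2⌉)
  import Data.Nat.Properties as ℕP
  open import Data.Nat.DivMod using (_mod_; m<n⇒m%n≡m; /-monoˡ-≤; m*n/n≡m)
  open import Data.Integer using (+_)
  open import Data.Rational as ℚ using ()
  open import Data.Fin using (toℕ)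
  import Data.Fin.Properties as FinP
  open import Data.Product as Prod using (∃-syntax; _×_; _,_; proj₁; proj₂; uncurry)
  open import Data.Sum using (_⊎_; inj₁; inj₂)
  open import Function using (_∘_; id)
  open import Data.List using (List; []; _∷_; _++_; map; concat; length; take; upTo; cartesianProduct)
  import Data.List.Properties as LP
  open import Data.List.Membership.Propositional using (_∈_)
  open import Data.List.Membership.Propositional.Properties
    using (∈-map⁻; ∈-++⁻; ∈-upTo⁻; ∈-cartesianProduct⁻)
  open import Data.List.Relation.Unary.Any using (here; there)
  open import Data.List.Relation.Unary.All as All using (All; []; _∷_)
  import Data.List.Relation.Unary.All.Properties as AllP
  open import Data.List.Relation.Unary.AllPairs using ([]; _∷_)
  open import Data.List.Relation.Unary.Unique.Propositional using (Unique)
  import Data.List.Relation.Unary.Unique.Propositional.Properties as UniqueP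
  open import Data.List.Relation.Binary.Pointwise using (Pointwise; []; _∷_)
  open import Data.List.Relation.Binary.Subset.Propositional using (_⊆_)
  open import Data.List.Relation.Binary.Subset.Propositional.Properties using (xs⊆xs++ys)
  open import Data.List.Relation.Binary.Disjoint.Propositional using (Disjoint)
  open import Relation.Nullary using (yes; no; contradiction)
  open import Relation.Binary.PropositionalEquality
  open FloorOfFractions using (⌊m/d*n⌋≡m*n/d)

  module _ {V W : Set} {A : V → V → Set} {B : W → W → Set} (f : V → W) where

    IsWalk-map : (∀ {a b} → A a b → B (f a) (f b)) →
                 ∀ {u v ws} → IsWalk A u v ws → IsWalk B (f u) (f v) (map f ws)
    IsWalk-map f-adj single     = single
    IsWalk-map f-adj (step a w) = step (f-adj a) (IsWalk-map f-adj w)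

    IsWalk-mapOn : {P : V → Set} → (∀ {a b} → P a → P b → A a b → B (f a) (f b)) →
                   ∀ {u v ws} → All P ws → IsWalk A u v ws → IsWalk B (f u) (f v) (map f ws)
    IsWalk-mapOn f-adj _          single     = single
    IsWalk-mapOn f-adj (pu ∷ pws) (step a w) = step (f-adj pu (head pws w) a) (IsWalk-mapOn f-adj pws w)
      where
      head : ∀ {P : V → Set} {u v ws} → All P ws → IsWalk A u v ws → P u
      head (pu ∷ _) single   = pu
      head (pu ∷ _) (step _ _) = pu

  IsWalk-++ : {V : Set} {A : V → V → Set} {a b c d : V} {P Q : List V} →
              IsWalk A a b P → A b c → IsWalk A c d Q → IsWalk A a d (P ++ Q)
  IsWalk-++ single     bc wq = step bc wq
  IsWalk-++ (step x w) bc wq = step x (IsWalk-++ w bc wq)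

  Unique-map⁺-leftInverse : {A B : Set} {f : A → B} (g : B → A) {xs : List A} →
                            All (λ x → g (f x) ≡ x) xs → Unique xs → Unique (map f xs)
  Unique-map⁺-leftInverse {f = f} g {xs} g∘f≗id xs-unique =
    UniqueP.map⁻ (subst Unique (sym g∘f∘xs≡xs) xs-unique)
    where
    g∘f∘xs≡xs : map g (map f xs) ≡ xs
    g∘f∘xs≡xs = trans (sym (LP.map-∘ xs)) (LP.map-id-local g∘f≗id)

  take-⊆ : {A : Set} (n : ℕ) (xs : List A) → take n xs ⊆ xs
  take-⊆ n xs = subst (take n xs ⊆_) (LP.take++drop≡id n xs) (xs⊆xs++ys (take n xs) _)

  MatchingLinked-⊆ : {V : Set} {Adj : V → V → Set} {X Y : List V} →
                     Y ⊆ X → MatchingLinked Adj X → MatchingLinked Adj Y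
  MatchingLinked-⊆ Y⊆X linked M (M⊆Y , M-unique) = linked M (All.map Y⊆X M⊆Y , M-unique)

  length-cartesianProduct : {A B : Set} (xs : List A) (ys : List B) →
                            length (cartesianProduct xs ys) ≡ length xs * length ys
  length-cartesianProduct []       ys = refl
  length-cartesianProduct (x ∷ xs) ys = begin
    length (map (x ,_) ys ++ cartesianProduct xs ys)         ≡⟨ LP.length-++ (map (x ,_) ys) ⟩
    length (map (x ,_) ys) + length (cartesianProduct xs ys) ≡⟨ cong₂ _+_ (LP.length-map (x ,_) ys)
                                                                          (length-cartesianProduct xs ys) ⟩
    length ys + length xs * length ys                        ∎
    where open ≡-Reasoning

  module OwnedRoutes {T V : Set} (Adj : V → V → Set) (ts : List T)
    (terminal : T → V) (owner : V → T) (route : T → T → List V)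
    (owner-terminal : ∀ {a} → a ∈ ts → owner (terminal a) ≡ a)
    (route-walk : ∀ {a b} → a ∈ ts → b ∈ ts → IsWalk Adj (terminal a) (terminal b) (route a b))
    (route-unique : ∀ {a b} → a ∈ ts → b ∈ ts → a ≢ b → Unique (route a b))
    (route-owned : ∀ {a b} → a ∈ ts → b ∈ ts → All (λ w → owner w ≡ a ⊎ owner w ≡ b) (route a b))
    where

    terminal² : T × T → V × V
    terminal² = Prod.map terminal terminal

    routes : List (T × T) → List (List V)
    routes = map (uncurry route)

    endpoints-map : ∀ N → endpoints (map terminal² N) ≡ map terminal (endpoints N)
    endpoints-map []            = refl
    endpoints-map ((a , b) ∷ N) = cong (λ es → terminal a ∷ terminal b ∷ es) (endpoints-map N)

    lift-matching : ∀ M → All (_∈ map terminal ts) (endpoints M) →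
                    ∃[ N ] (M ≡ map terminal² N × All (_∈ ts) (endpoints N))
    lift-matching []            _ = [] , refl , []
    lift-matching ((u , v) ∷ M) (u∈ ∷ v∈ ∷ M⊆)
      with a , a∈ , refl ← ∈-map⁻ terminal u∈
         | b , b∈ , refl ← ∈-map⁻ terminal v∈
         | N , refl , N⊆ ← lift-matching M M⊆
      = (a , b) ∷ N , refl , a∈ ∷ b∈ ∷ N⊆

    routes-link : ∀ N → All (_∈ ts) (endpoints N) → Pointwise (Links Adj) (routes N) (map terminal² N)
    routes-link []            _                = []
    routes-link ((a , b) ∷ N) (a∈ ∷ b∈ ∷ N⊆) = route-walk a∈ b∈ ∷ routes-link N N⊆

    owner-∈-endpoints : ∀ N → All (_∈ ts) (endpoints N) →
                        ∀ {w} → w ∈ concat (routes N) → owner w ∈ endpoints N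
    owner-∈-endpoints ((a , b) ∷ N) (a∈ ∷ b∈ ∷ N⊆) w∈ with ∈-++⁻ (route a b) w∈
    ... | inj₂ w∈rest = there (there (owner-∈-endpoints N N⊆ w∈rest))
    ... | inj₁ w∈route with All.lookup (route-owned a∈ b∈) w∈route
    ...   | inj₁ owner≡a = here owner≡a
    ...   | inj₂ owner≡b = there (here owner≡b)

    routes-unique : ∀ N → All (_∈ ts) (endpoints N) → Unique (endpoints N) → Unique (concat (routes N))
    routes-unique []            _                _ = []
    routes-unique ((a , b) ∷ N) (a∈ ∷ b∈ ∷ N⊆) ((a≢b ∷ a∉N) ∷ (b∉N ∷ N-unique)) =
      UniqueP.++⁺ (route-unique a∈ b∈ a≢b) (routes-unique N N⊆ N-unique) disjoint
      where
      disjoint : Disjoint (route a b) (concat (routes N))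
      disjoint (w∈route , w∈rest) with All.lookup (route-owned a∈ b∈) w∈route
      ... | inj₁ refl = All.lookup a∉N (owner-∈-endpoints N N⊆ w∈rest) refl
      ... | inj₂ refl = All.lookup b∉N (owner-∈-endpoints N N⊆ w∈rest) refl

    terminals-unique : Unique ts → Unique (map terminal ts)
    terminals-unique = Unique-map⁺-leftInverse owner (All.tabulate owner-terminal)

    terminals-matchingLinked : MatchingLinked Adj (map terminal ts)
    terminals-matchingLinked M (M⊆ , M-unique)
      with N , refl , N⊆ ← lift-matching M M⊆
      = routes N , routes-link N N⊆ ,
        routes-unique N N⊆ (UniqueP.map⁻ (subst Unique (endpoints-map N) M-unique))

  LineAdj : ℕ → ℕ → Set
  LineAdj a b = ∣ a - b ∣ ≡ 1

  segment : ℕ → ℕ → List ℕ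
  segment zero    zero    = 0 ∷ []
  segment zero    (suc j) = 0 ∷ map suc (segment zero j)
  segment (suc i) zero    = suc i ∷ segment i zero
  segment (suc i) (suc j) = map suc (segment i j)

  ∣1+n-n∣≡1 : ∀ n → ∣ suc n - n ∣ ≡ 1
  ∣1+n-n∣≡1 zero    = refl
  ∣1+n-n∣≡1 (suc n) = ∣1+n-n∣≡1 n

  segment-walk : ∀ i j → IsWalk LineAdj i j (segment i j)
  segment-walk zero    zero    = single
  segment-walk zero    (suc j) = step refl (IsWalk-map suc id (segment-walk zero j))
  segment-walk (suc i) zero    = step (∣1+n-n∣≡1 i) (segment-walk i zero)
  segment-walk (suc i) (suc j) = IsWalk-map suc id (segment-walk i j)

  segment-< : ∀ {n} i j → i < n → j < n → All (_< n) (segment i j)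
  segment-<         zero    zero    i<n _           = i<n ∷ []
  segment-< {suc n} zero    (suc j) i<n (s<s j<n)   =
    i<n ∷ AllP.map⁺ (All.map s<s (segment-< zero j (ℕP.≤-<-trans z≤n j<n) j<n))
  segment-<         (suc i) zero    i<n 0<n         = i<n ∷ segment-< i zero (ℕP.<-trans (ℕP.n<1+n i) i<n) 0<n
  segment-< {suc n} (suc i) (suc j) (s<s i<n) (s<s j<n) = AllP.map⁺ (All.map s<s (segment-< i j i<n j<n))

  segment-unique : ∀ i j → Unique (segment i j)
  segment-unique zero    zero    = [] ∷ []
  segment-unique zero    (suc j) =
    AllP.map⁺ (All.universal (λ _ ()) _) ∷ UniqueP.map⁺ ℕP.suc-injective (segment-unique zero j)
  segment-unique (suc i) zero    =
    All.map ℕP.>⇒≢ (segment-< i zero (ℕP.n<1+n i) z<s) ∷ segment-unique i zero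
  segment-unique (suc i) (suc j) = UniqueP.map⁺ ℕP.suc-injective (segment-unique i j)

  -- (row, column, layer) in the blow-up of the grid ℕ × ℕ by ℕ; routes are drawn here first.
  Point : Set
  Point = ℕ × ℕ × ℕ

  data _~_ : Point → Point → Set where
    grid-step  : ∀ {r c r′ c′ k} → ∣ r - r′ ∣ + ∣ c - c′ ∣ ≡ 1 → (r , c , k) ~ (r′ , c′ , k)
    layer-step : ∀ {r c k k′} → k ≢ k′ → (r , c , k) ~ (r , c , k′)

  column-step : ∀ {c k a b} → LineAdj a b → (a , c , k) ~ (b , c , k)
  column-step {c} a~b = grid-step (cong₂ _+_ a~b (ℕP.∣n-n∣≡0 c))

  row-step : ∀ {r k a b} → LineAdj a b → (r , a , k) ~ (r , b , k)
  row-step {r} a~b = grid-step (cong₂ _+_ (ℕP.∣n-n∣≡0 r) a~b)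

  InBox : ℕ → ℕ → Point → Set
  InBox ℓ t (r , c , k) = r < ℓ × c < ℓ × k < t

  toℕ-mod : ∀ {m n} .{{_ : NonZero n}} → m < n → toℕ (m mod n) ≡ m
  toℕ-mod m<n = trans (FinP.toℕ-fromℕ< _) (m<n⇒m%n≡m m<n)

  module Box (ℓ t : ℕ) .{{_ : NonZero ℓ}} .{{_ : NonZero t}} where

    -- only ever applied to points of InBox ℓ t, on which mod is the identity
    embed : Point → BlowV ℓ t
    embed (r , c , k) = (r mod ℓ , c mod ℓ) , k mod t

    unembed : BlowV ℓ t → Point
    unembed ((r , c) , k) = toℕ r , toℕ c , toℕ k

    unembed-embed : ∀ {x} → InBox ℓ t x → unembed (embed x) ≡ x
    unembed-embed (r<ℓ , c<ℓ , k<t) = cong₂ _,_ (toℕ-mod r<ℓ) (cong₂ _,_ (toℕ-mod c<ℓ) (toℕ-mod k<t))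

    embed-adj : ∀ {x y} → InBox ℓ t x → InBox ℓ t y → x ~ y → BlowAdj ℓ t (embed x) (embed y)
    embed-adj {r , c , _} {r′ , c′ , _} (r<ℓ , c<ℓ , _) (r′<ℓ , c′<ℓ , _) (grid-step e)
      rewrite toℕ-mod r<ℓ | toℕ-mod r′<ℓ | toℕ-mod c<ℓ | toℕ-mod c′<ℓ
      = inj₁ (subst₂ (λ x y → x + y ≡ 1) (ℕP.∣-∣≡∣-∣′ r r′) (ℕP.∣-∣≡∣-∣′ c c′) e)
    embed-adj (_ , _ , k<t) (_ , _ , k′<t) (layer-step k≢k′) =
      inj₂ (refl , λ k≡k′ →
        k≢k′ (trans (sym (toℕ-mod k<t)) (trans (cong toℕ k≡k′) (toℕ-mod k′<t))))

    embed-walk : ∀ {u v P} → All (InBox ℓ t) P → IsWalk _~_ u v P →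
                 IsWalk (BlowAdj ℓ t) (embed u) (embed v) (map embed P)
    embed-walk = IsWalk-mapOn embed embed-adj

    embed-All : ∀ {Q : Point → Set} {P} → All (InBox ℓ t) P → All Q P → All (Q ∘ unembed) (map embed P)
    embed-All {Q} P-inBox QP =
      AllP.map⁺ (All.zipWith (λ (x-inBox , Qx) → subst Q (sym (unembed-embed x-inBox)) Qx) (P-inBox , QP))

    embed-unique : ∀ {P} → All (InBox ℓ t) P → Unique P → Unique (map embed P)
    embed-unique P-inBox = Unique-map⁺-leftInverse unembed (All.map unembed-embed P-inBox)

  module GridRoutes (ℓ s : ℕ) where

    Terminal : Set
    Terminal = ℕ × ℕ

    column : ℕ → ℕ → List ℕ → List Point
    column col k = map (λ r → r , col , k)

    row : ℕ → ℕ → List ℕ → List Point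
    row r k = map (λ col → r , col , k)

    route : Terminal → Terminal → List Point
    route (i , c) (j , c′) =
      column i c (segment 0 i) ++ row i (s + c) (segment i j) ++ column j c′ (segment i 0)

    owner : Point → Terminal
    owner (r , col , k) with k <? s
    ... | yes _ = col , k
    ... | no  _ = r , k ∸ s

    owner-low : ∀ {r col k} → k < s → owner (r , col , k) ≡ (col , k)
    owner-low {k = k} k<s with k <? s
    ... | yes _   = refl
    ... | no  k≮s = contradiction k<s k≮s

    owner-high : ∀ {r col c} → owner (r , col , s + c) ≡ (r , c)
    owner-high {r} {c = c} with s + c <? s
    ... | yes s+c<s = contradiction s+c<s (ℕP.m+n≮m s c)
    ... | no  _     = cong (r ,_) (ℕP.m+n∸m≡n s c)

    low≢high : ∀ {c c′} → c < s → c ≢ s + c′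
    low≢high {c′ = c′} c<s refl = ℕP.m+n≮m s c′ c<s

    map-disjoint : ∀ {A : Set} {f g : A → Point} {xs ys} →
                   (∀ x y → f x ≢ g y) → Disjoint (map f xs) (map g ys)
    map-disjoint {f = f} {g} f≢g (v∈fxs , v∈gys)
      with x , _ , refl ← ∈-map⁻ f v∈fxs
         | y , _ , fx≡gy ← ∈-map⁻ g v∈gys
      = f≢g x y fx≡gy

    layer : Point → ℕ
    layer (_ , _ , k) = k

    InRange : Terminal → Set
    InRange (i , c) = i < ℓ × c < s

    point : Terminal → Point
    point (i , c) = 0 , i , c

    low<t : ∀ {k t} → s + s ≤ t → k < s → k < t
    low<t s+s≤t k<s = ℕP.<-≤-trans k<s (ℕP.≤-trans (ℕP.m≤m+n s s) s+s≤t)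

    point-inBox : ∀ {t a} → s + s ≤ t → InRange a → InBox ℓ t (point a)
    point-inBox s+s≤t (i<ℓ , c<s) = ℕP.≤-<-trans z≤n i<ℓ , i<ℓ , low<t s+s≤t c<s

    owner-point : ∀ {a} → InRange a → owner (point a) ≡ a
    owner-point (_ , c<s) = owner-low c<s

    route-walk : ∀ {a b} → InRange a → InRange b → IsWalk _~_ (point a) (point b) (route a b)
    route-walk {i , c} {j , c′} (_ , c<s) (_ , c′<s) =
      IsWalk-++ (IsWalk-map _ column-step (segment-walk 0 i))
        (layer-step (low≢high c<s))
        (IsWalk-++ (IsWalk-map _ row-step (segment-walk i j))
          (layer-step (≢-sym (low≢high c′<s)))
          (IsWalk-map _ column-step (segment-walk i 0)))

    route-owned : ∀ {a b} → InRange a → InRange b → All (λ w → owner w ≡ a ⊎ owner w ≡ b) (route a b)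
    route-owned {i , c} {j , c′} (_ , c<s) (_ , c′<s) =
      AllP.++⁺ (AllP.map⁺ (All.universal (λ _ → inj₁ (owner-low c<s)) (segment 0 i)))
        (AllP.++⁺ (AllP.map⁺ (All.universal (λ _ → inj₁ owner-high) (segment i j)))
                  (AllP.map⁺ (All.universal (λ _ → inj₂ (owner-low c′<s)) (segment i 0))))

    route-unique : ∀ {a b} → InRange a → InRange b → a ≢ b → Unique (route a b)
    route-unique {i , c} {j , c′} (_ , c<s) (_ , c′<s) ic≢jc′ =
      UniqueP.++⁺ (UniqueP.map⁺ (cong proj₁) (segment-unique 0 i))
        (UniqueP.++⁺ (UniqueP.map⁺ (cong (proj₁ ∘ proj₂)) (segment-unique i j))
                     (UniqueP.map⁺ (cong proj₁) (segment-unique i 0))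
                     (map-disjoint λ _ _ → ≢-sym (low≢high c′<s) ∘ cong layer))
        first-disjoint
      where
      first-disjoint : Disjoint (column i c (segment 0 i))
                                (row i (s + c) (segment i j) ++ column j c′ (segment i 0))
      first-disjoint (v∈first , v∈rest) with ∈-++⁻ (row i (s + c) (segment i j)) v∈rest
      ... | inj₁ v∈row  = map-disjoint (λ _ _ → low≢high c<s ∘ cong layer) (v∈first , v∈row)
      ... | inj₂ v∈last = map-disjoint (λ _ _ → ic≢jc′ ∘ cong proj₂) (v∈first , v∈last)

    route-inBox : ∀ {t a b} → s + s ≤ t → InRange a → InRange b → All (InBox ℓ t) (route a b)
    route-inBox {t} {i , c} {j , c′} s+s≤t (i<ℓ , c<s) (j<ℓ , c′<s) =
      AllP.++⁺ (AllP.map⁺ (All.map (λ r<ℓ → r<ℓ , i<ℓ , low<t s+s≤t c<s) (segment-< 0 i 0<ℓ i<ℓ)))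
        (AllP.++⁺ (AllP.map⁺ (All.map (λ col<ℓ → i<ℓ , col<ℓ , high<t) (segment-< i j i<ℓ j<ℓ)))
                  (AllP.map⁺ (All.map (λ r<ℓ → r<ℓ , j<ℓ , low<t s+s≤t c′<s) (segment-< i 0 i<ℓ 0<ℓ))))
      where
      0<ℓ : 0 < ℓ
      0<ℓ = ℕP.≤-<-trans z≤n i<ℓ
      high<t : s + c < t
      high<t = ℕP.<-≤-trans (ℕP.+-monoʳ-< s c<s) s+s≤t

  blowup-linked-sets : ∀ ℓ t .{{_ : NonZero ℓ}} .{{_ : NonZero t}} → ∀ n → n ≤ ℓ * ⌊ t /2⌋ →
                       ∃[ X ] (Unique X × MatchingLinked (BlowAdj ℓ t) X × length X ≡ n)
  blowup-linked-sets ℓ t n n≤ℓs =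
    take n X , UniqueP.take⁺ n X-unique , MatchingLinked-⊆ (take-⊆ n X) X-linked , length-take-X
    where
    s = ⌊ t /2⌋
    open Box ℓ t
    open GridRoutes ℓ s

    s+s≤t : s + s ≤ t
    s+s≤t = begin
      s + s        ≤⟨ ℕP.+-monoʳ-≤ s (ℕP.⌊n/2⌋≤⌈n/2⌉ t) ⟩
      s + ⌈ t /2⌉  ≡⟨ ℕP.⌊n/2⌋+⌈n/2⌉≡n t ⟩
      t            ∎
      where open ℕP.≤-Reasoning

    terminals : List Terminal
    terminals = cartesianProduct (upTo ℓ) (upTo s)

    terminal : Terminal → BlowV ℓ t
    terminal = embed ∘ point

    X : List (BlowV ℓ t)
    X = map terminal terminals

    in-range : ∀ {a} → a ∈ terminals → InRange a
    in-range a∈ = Prod.map ∈-upTo⁻ ∈-upTo⁻ (∈-cartesianProduct⁻ (upTo ℓ) (upTo s) a∈)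

    owner-terminal : ∀ {a} → a ∈ terminals → owner (unembed (terminal a)) ≡ a
    owner-terminal a∈ =
      trans (cong owner (unembed-embed (point-inBox s+s≤t (in-range a∈)))) (owner-point (in-range a∈))

    module _ {a b} (a∈ : a ∈ terminals) (b∈ : b ∈ terminals) where

      route-boxed : All (InBox ℓ t) (route a b)
      route-boxed = route-inBox s+s≤t (in-range a∈) (in-range b∈)

      embedded-route-walk : IsWalk (BlowAdj ℓ t) (terminal a) (terminal b) (map embed (route a b))
      embedded-route-walk = embed-walk route-boxed (route-walk (in-range a∈) (in-range b∈))

      embedded-route-unique : a ≢ b → Unique (map embed (route a b))
      embedded-route-unique a≢b = embed-unique route-boxed (route-unique (in-range a∈) (in-range b∈) a≢b)

      embedded-route-owned : All (λ v → owner (unembed v) ≡ a ⊎ owner (unembed v) ≡ b)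
                                 (map embed (route a b))
      embedded-route-owned = embed-All route-boxed (route-owned (in-range a∈) (in-range b∈))

    open OwnedRoutes (BlowAdj ℓ t) terminals terminal (owner ∘ unembed) (λ a b → map embed (route a b))
      owner-terminal embedded-route-walk embedded-route-unique embedded-route-owned

    X-unique : Unique X
    X-unique = terminals-unique (UniqueP.cartesianProduct⁺ (UniqueP.upTo⁺ ℓ) (UniqueP.upTo⁺ s))

    X-linked : MatchingLinked (BlowAdj ℓ t) X
    X-linked = terminals-matchingLinked

    length-X : length X ≡ ℓ * s
    length-X = begin
      length X                           ≡⟨ LP.length-map terminal terminals ⟩
      length terminals                   ≡⟨ length-cartesianProduct (upTo ℓ) (upTo s) ⟩
      length (upTo ℓ) * length (upTo s)  ≡⟨ cong₂ _*_ (LP.length-upTo ℓ) (LP.length-upTo s) ⟩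
      ℓ * s                              ∎
      where open ≡-Reasoning

    length-take-X : length (take n X) ≡ n
    length-take-X = trans (LP.length-take n X) (trans (cong (n ℕ.⊓_) length-X) (ℕP.m≤n⇒m⊓n≡m n≤ℓs))

  n≤1+⌊n/2⌋*2 : ∀ n → n ≤ suc (⌊ n /2⌋ * 2)
  n≤1+⌊n/2⌋*2 zero          = z≤n
  n≤1+⌊n/2⌋*2 (suc zero)    = s≤s z≤n
  n≤1+⌊n/2⌋*2 (suc (suc n)) = s≤s (s≤s (n≤1+⌊n/2⌋*2 n))

  n≤⌊n/2⌋*6 : ∀ {n} → 2 ≤ n → n ≤ ⌊ n /2⌋ * 6
  n≤⌊n/2⌋*6 {n@(suc (suc m))} (s≤s (s≤s _)) =
    ℕP.≤-trans (n≤1+⌊n/2⌋*2 n)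
               (ℕP.+-mono-≤ (ℕP.m≤m+n 3 3) (ℕP.*-monoʳ-≤ ⌊ m /2⌋ (ℕP.m≤m+n 2 4)))

  m*n/6≤m*⌊n/2⌋ : ∀ m n → 2 ≤ n → m * n / 6 ≤ m * ⌊ n /2⌋
  m*n/6≤m*⌊n/2⌋ m n 2≤n = begin
    m * n / 6               ≤⟨ /-monoˡ-≤ 6 (ℕP.*-monoʳ-≤ m (n≤⌊n/2⌋*6 2≤n)) ⟩
    m * (⌊ n /2⌋ * 6) / 6   ≡⟨ cong (_/ 6) (ℕP.*-assoc m ⌊ n /2⌋ 6) ⟨
    m * ⌊ n /2⌋ * 6 / 6     ≡⟨ m*n/n≡m (m * ⌊ n /2⌋) 6 ⟩
    m * ⌊ n /2⌋             ∎
    where open ℕP.≤-Reasoning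

  admissible-[ℓ-1]/6 : ∀ L → Admissible (suc (suc L)) (+ suc L ℚ./ 6)
  admissible-[ℓ-1]/6 L = 2 , λ where
    t@(suc _) 2≤t →
      let enough = ℕP.≤-trans (m*n/6≤m*⌊n/2⌋ (suc L) t 2≤t)
                              (ℕP.*-monoˡ-≤ ⌊ t /2⌋ (ℕP.n≤1+n (suc L)))
          X , X-unique , X-linked , |X|≡n = blowup-linked-sets (suc (suc L)) t (suc L * t / 6) enough
      in  X , X-unique , X-linked , trans (cong +_ |X|≡n) (sym (⌊m/d*n⌋≡m*n/d (suc L) t 6))

open import Data.Nat using (ℕ; zero; suc)
open import Data.Integer as ℤ using (+_; _-_)
open import Data.Rational as ℚ using (ℚ; _<_; _≤_; _/_; 0ℚ)
import Data.Rational.Properties as ℚP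
open import Data.Product using (∃-syntax; _×_; _,_)
open Linkage using (admissible-[ℓ-1]/6)

lemma19 : (ℓ : ℕ) → (q : ℚ) → 0ℚ < q → q < ((+ ℓ - + 1) / 6) →
    ∃[ c ] (q ≤ c × Admissible ℓ c)
lemma19 zero          q 0<q q<c with ℚ.*<* ()          ← ℚP.<-trans 0<q q<c
lemma19 (suc zero)    q 0<q q<c with ℚ.*<* (ℤ.+<+ ()) ← ℚP.<-trans 0<q q<c
lemma19 (suc (suc L)) q _   q<c = _ , ℚP.<⇒≤ q<c , admissible-[ℓ-1]/6 L
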